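{- Set $\bar s = s_k$, and define \begin{eqnarray*} L(n) & = & \left\{ (u,v): 0 \leq u \leq p-1 \mbox{ and } 0 \leq v \leq \bar s-1 \right\} \\ R(n) & = & \left\{ (u,v): 0 \leq u \leq p-2 \mbox{ and } n-\bar s \leq v \leq n-1 \right\} \cup \left\{ (p-1,v): n+s-\bar s \leq v \leq n+s-1 \right\}. \end{eqnarray*} Then \begin{eqnarray*} \mathtt{Hook}(n) &\subseteq& R(n) \times L(n), \\ \mathtt{New}(n) &\subseteq& \left( R(n) \times NV(n) \right) \cup \left( NV(n) \times NV(n) \right). \end{eqnarray*}
   Context: Let $p,s$, $p_1,\ldots,p_k$ and $s_1,\ldots,s_k$ be non-negative integer constants with $0\le p_i<p$ for all $i$ and $s_i \ge s \ge 0$ for all $i$ (one may also assume $0\le s<p$), with $s_k$ the largest of the $s_i$. The jump set is $S=\{p_1n+s_1,\ldots,p_kn+s_k\}$. For integers $u,v,n$ set $f(n;u,v)=un+v$. The vertex set is $\widehat V(n)=\{(u,v): 0\le u\le p-2,\ 0\le v\le n-1\}\cup\{(p-1,v): 0\le v\le n+s-1\}$ (so $|\widehat V(n)|=pn+s$). The circulant edge set is $\widehat E_C(n)=\{((u_1,v_1),(u_2,v_2)) : (u_1,v_1),(u_2,v_2)\in\widehat V(n),\ \exists i,\ f(n;u_2,v_2)-f(n;u_1,v_1)\equiv p_in+s_i \pmod{pn+s}\}$; the graph $(\widehat V(n),\widehat E_C(n))$ is isomorphic to the directed circulant graph on $pn+s$ vertices with jumps $S$. The lattice edge set $\widehat E_L(n)$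 consists of those edges of $\widehat E_C(n)$ for which, for the same $i$, additionally $u_2-u_1\equiv p_i \pmod p$; the lattice graph is $L_n=(\widehat V(n),\widehat E_L(n))$. Define $\mathtt{Hook}(n)=\widehat E_C(n)-\widehat E_L(n)$, $\mathtt{New}(n)=\widehat E_L(n+1)-\widehat E_L(n)$, and $NV(n)=\widehat V(n+1)-\widehat V(n)$ (the new vertices added when passing from $n$ to $n+1$). It is assumed that $n\ge 2\bar s$. -}

module Defs where

open import Data.Nat using (ℕ; _+_; _*_; _∸_; _≤_; _<_)
open import Data.Fin using (Fin; fromℕ)
open import Data.Integer using (ℤ; +_) renaming (_-_ to _-ℤ_)
open import Data.Integer.Divisibility using (_∣_)
open import Data.Product using (Σ; _×_; _,_)
open import Relation.Binary.PropositionalEquality using (_≡_)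
open import Relation.Nullary using (¬_)

_≡_[mod_] : ℤ → ℤ → ℕ → Set
a ≡ b [mod m ] = (+ m) ∣ (a -ℤ b)

Vertex : Set
Vertex = ℕ × ℕ

Edge : Set
Edge = Vertex × Vertex

f : ℕ → Vertex → ℕ
f n (u , v) = u * n + v

-- The data of the problem: p, s and k+1 jumps p_i n + s_i (indices Fin (suc k);
-- the last index  fromℕ k  plays the role of the paper's index k).
module Setup (p s k : ℕ) (ps ss : Fin (Data.Nat.suc k) → ℕ) where

  sbar : ℕ
  sbar = ss (fromℕ k)

  V : ℕ → Vertex → Set
  V n (u , v) = (u + 2 ≤ p × v < n) Data.Sum.⊎ (u + 1 ≡ p × v < n + s)
    where import Data.Sum

  Jump : ℕ → Fin (Data.Nat.suc k) → Edge → Set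
  Jump n i (a , b) = (+ f n b -ℤ + f n a) ≡ + (ps i * n + ss i) [mod p * n + s ]

  EC : ℕ → Edge → Set
  EC n (a , b) = V n a × V n b × Σ (Fin (Data.Nat.suc k)) (λ i → Jump n i (a , b))

  EL : ℕ → Edge → Set
  EL n ((u₁ , v₁) , (u₂ , v₂)) =
    V n (u₁ , v₁) × V n (u₂ , v₂) ×
    Σ (Fin (Data.Nat.suc k)) (λ i →
      Jump n i ((u₁ , v₁) , (u₂ , v₂)) × ((+ u₂ -ℤ + u₁) ≡ + ps i [mod p ]))

  Hook : ℕ → Edge → Set
  Hook n e = EC n e × ¬ EL n e

  New : ℕ → Edge → Set
  New n e = EL (Data.Nat.suc n) e × ¬ EL n e

  NV : ℕ → Vertex → Set
  NV n x = V (Data.Nat.suc n) x × ¬ V n x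

  Lset : ℕ → Vertex → Set
  Lset n (u , v) = u < p × v < sbar

  Rset : ℕ → Vertex → Set
  Rset n (u , v) =
    (u + 2 ≤ p × n ∸ sbar ≤ v × v < n) Data.Sum.⊎
    (u + 1 ≡ p × (n + s) ∸ sbar ≤ v × v < n + s)
    where import Data.Sum

module Submission where

-- Lay out the circulant on N = pm + s vertices as the rows of \hat V(m), the vertex
-- (u , v) sitting at position u m + v < N.  For an edge of jump index i, both sides
-- of f b ≡ f a + p_i m + s_i (mod N) lie below 2N, so it is an equation up to a
-- carry bit c: f b + c N = f a + p_i m + s_i.  Read as two-digit numbers in base m
-- (row, column) it is either a lattice step, (u₂ , v₂) + c (p , s) = (u₁ + p_i , v₁ + s_i),
-- or a hook step whose column overflows into the next row.  Lattice steps between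
-- vertices are lattice edges, while hook steps break the row congruence mod p.  So a
-- hook edge is a hook step, which puts its source in R and its target in L; and a
-- new lattice edge is a lattice step, which cannot go from a new vertex to an old one
-- and, going from an old vertex to a new one, must start in R.

open import Defs
open import Data.Nat using (ℕ; suc; _≤_; _<_; _*_)
open import Data.Fin using (Fin; fromℕ)
open import Data.Product using (_×_; _,_)
open import Data.Sum using (_⊎_)

open import Data.Nat using (zero; _+_; _∸_; z≤n; s≤s; s≤s⁻¹; z<s; _≤?_; _<?_; _≟_)
open import Data.Nat.Properties
open import Data.Nat.Divisibility as ℕ∣ using (divides-refl; _∣0; ∣-refl)
open import Data.Nat.Tactic.RingSolver using (solve-∀)
open import Data.Integer using (+_; _⊖_; ∣_∣) renaming (_-_ to _-ℤ_; _+_ to _+ℤ_)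
import Data.Integer.Properties as ℤ
import Data.Integer.Tactic.RingSolver as ℤRing
open import Data.Bool using (Bool; true; false)
open import Data.Product using (∃; proj₁; proj₂; Σ)
open import Data.Sum using (inj₁; inj₂; [_,_]′)
open import Data.Empty using (⊥; ⊥-elim)
open import Relation.Binary.PropositionalEquality
open import Relation.Binary.Definitions using (tri<; tri≈; tri>)
open import Relation.Nullary using (¬_; Dec; yes; no)
open import Relation.Nullary.Decidable using (_×-dec_; _⊎-dec_)

infixl 6 _+[_]_
_+[_]_ : ℕ → Bool → ℕ → ℕ
x +[ false ] m = x
x +[ true  ] m = x + m

≤-+[] : ∀ x c m → x ≤ x +[ c ] m
≤-+[] x false m = ≤-refl
≤-+[] x true  m = m≤m+n x m

+[]-swap : ∀ x c t m → x +[ c ] t + m ≡ x + (m +[ c ] t)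
+[]-swap x false t m = refl
+[]-swap x true  t m = trans (+-assoc x t m) (cong (λ w → x + w) (+-comm t m))

carry-step : ∀ c c′ x m → x +[ c ] m ≡ suc (x +[ c′ ] m) → m ≡ 1
carry-step false false x m eq = ⊥-elim (<⇒≢ (n<1+n x) eq)
carry-step false true  x m eq = ⊥-elim (<⇒≢ (s≤s (m≤m+n x m)) eq)
carry-step true  false x m eq = +-cancelˡ-≡ x m 1 (trans eq (+-comm 1 x))
carry-step true  true  x m eq = ⊥-elim (<⇒≢ (n<1+n (x + m)) eq)

multiple-below : ∀ {m d} → m ℕ∣.∣ d → d < m → d ≡ 0
multiple-below (divides-refl zero)    _   = refl
multiple-below {m} (divides-refl (suc q)) d<m = ⊥-elim (<⇒≱ d<m (m≤m+n m (q * m)))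

multiple-below-double : ∀ {m d} → m ℕ∣.∣ d → 0 < d → d < m + m → d ≡ m
multiple-below-double (divides-refl zero) () _
multiple-below-double {m} (divides-refl (suc zero)) _ _ = +-identityʳ m
multiple-below-double {m} (divides-refl (suc (suc q))) _ d<2m =
  ⊥-elim (<⇒≱ d<2m (+-monoʳ-≤ m (m≤m+n m (q * m))))

sub-sub-⊖ : ∀ x y z → (+ x -ℤ + y) -ℤ + z ≡ x ⊖ (y + z)
sub-sub-⊖ x y z = begin
  (+ x -ℤ + y) -ℤ + z      ≡⟨ sub-sub (+ x) (+ y) (+ z) ⟩
  + x -ℤ (+ y +ℤ + z)      ≡⟨ cong (+ x -ℤ_) (sym (ℤ.pos-+ y z)) ⟩
  + x -ℤ + (y + z)         ≡⟨ ℤ.[+m]-[+n]≡m⊖n x (y + z) ⟩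
  x ⊖ (y + z)              ∎
  where
  open ≡-Reasoning
  sub-sub : ∀ a b c → (a -ℤ b) -ℤ c ≡ a -ℤ (b +ℤ c)
  sub-sub = ℤRing.solve-∀

congruence-from-carry : ∀ m c x y z → x +[ c ] m ≡ y + z → (+ x -ℤ + y) ≡ + z [mod m ]
congruence-from-carry m c x y z eq =
  subst (m ℕ∣.∣_) (cong ∣_∣ (sym (sub-sub-⊖ x y z))) (distance-divisible c eq)
  where
  distance-divisible : ∀ c → x +[ c ] m ≡ y + z → m ℕ∣.∣ ∣ x ⊖ (y + z) ∣
  distance-divisible false x≡w rewrite sym x≡w | ℤ.n⊖n≡0 x = m ∣0
  distance-divisible true  x+m≡w rewrite sym x+m≡w =
    subst (m ℕ∣.∣_) (sym (trans (ℤ.∣⊖∣-≤ (m≤m+n x m)) (m+n∸m≡n x m))) ∣-refl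

carry-from-congruence : ∀ m x y z → x < m → y + z < m + m →
  (+ x -ℤ + y) ≡ + z [mod m ] → ∃ λ c → x +[ c ] m ≡ y + z
carry-from-congruence m x y z x<m w<2m congruent with y + z ≤? x
... | yes w≤x = false , ≤-antisym (m∸n≡0⇒m≤n distance≡0) w≤x
  where
  distance-divisible : m ℕ∣.∣ (x ∸ (y + z))
  distance-divisible =
    subst (m ℕ∣.∣_) (cong ∣_∣ (trans (sub-sub-⊖ x y z) (ℤ.⊖-≥ w≤x))) congruent
  distance≡0 : x ∸ (y + z) ≡ 0
  distance≡0 = multiple-below distance-divisible (≤-<-trans (m∸n≤m x (y + z)) x<m)
... | no w≰x = true , trans (cong (λ w → x + w) (sym distance≡m)) (m+[n∸m]≡n (<⇒≤ x<w))
  where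
  x<w : x < y + z
  x<w = ≰⇒> w≰x
  distance-divisible : m ℕ∣.∣ (y + z ∸ x)
  distance-divisible =
    subst (m ℕ∣.∣_) (trans (cong ∣_∣ (sub-sub-⊖ x y z)) (ℤ.∣⊖∣-< x<w)) congruent
  distance≡m : y + z ∸ x ≡ m
  distance≡m = multiple-below-double distance-divisible (m<n⇒0<n∸m x<w)
    (≤-<-trans (m∸n≤m (y + z) x) w<2m)

<⇒offset : ∀ {A B} → A < B → ∃ λ k → A + suc k ≡ B
<⇒offset {A} A<B with m≤n⇒∃[o]m+o≡n A<B
... | k , eq = k , trans (+-suc A k) eq

shift-digits : ∀ m A j X Y → A * m + X ≡ (A + j) * m + Y → X ≡ j * m + Y
shift-digits m A j X Y eq = +-cancelˡ-≡ (A * m) X (j * m + Y) (trans eq (regroup A j m Y))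
  where
  regroup : ∀ A j m Y → (A + j) * m + Y ≡ A * m + (j * m + Y)
  regroup = solve-∀

digits-compare : ∀ m A X B Y → A * m + X ≡ B * m + Y → X < m + m →
  (A ≡ B × X ≡ Y) ⊎ (suc A ≡ B × X ≡ Y + m) ⊎ (B < A × X + m ≤ Y)
digits-compare m A X B Y eq X<2m with <-cmp A B
... | tri≈ _ refl _ = inj₁ (refl , +-cancelˡ-≡ (A * m) X Y eq)
... | tri< A<B _ _ with <⇒offset A<B
...   | zero , refl = inj₂ (inj₁ (+-comm 1 A , X≡Y+m))
  where
  X≡Y+m : X ≡ Y + m
  X≡Y+m = trans (shift-digits m A 1 X Y eq) (trans (cong (_+ Y) (+-identityʳ m)) (+-comm m Y))
...   | suc k , refl = ⊥-elim (<⇒≱ X<2m (begin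
  m + m                   ≤⟨ +-monoʳ-≤ m (m≤m+n m (k * m)) ⟩
  m + (m + k * m)         ≤⟨ m≤m+n _ Y ⟩
  m + (m + k * m) + Y     ≡⟨ sym (shift-digits m A (suc (suc k)) X Y eq) ⟩
  X                       ∎))
  where open ≤-Reasoning
digits-compare m A X B Y eq X<2m | tri> _ _ B<A with <⇒offset B<A
... | k , refl = inj₂ (inj₂ (B<A , (begin
  X + m                   ≡⟨ +-comm X m ⟩
  m + X                   ≤⟨ +-monoˡ-≤ X (m≤m+n m (k * m)) ⟩
  m + k * m + X           ≡⟨ sym (shift-digits m B (suc k) Y X (sym eq)) ⟩
  Y                       ∎)))
  where open ≤-Reasoning

digits-bound : ∀ m t u v P → u < P → v < m + t → u * m + v < P * m + t
digits-bound m t u v P u<P v<m+t = begin-strict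
  u * m + v            <⟨ +-monoʳ-< (u * m) v<m+t ⟩
  u * m + (m + t)      ≡⟨ regroup u m t ⟩
  suc u * m + t        ≤⟨ +-monoˡ-≤ t (*-monoˡ-≤ m u<P) ⟩
  P * m + t            ∎
  where
  open ≤-Reasoning
  regroup : ∀ u m t → u * m + (m + t) ≡ suc u * m + t
  regroup = solve-∀

add-digits : ∀ m a b c d → (a * m + b) + (c * m + d) ≡ (a + c) * m + (b + d)
add-digits = solve-∀

carry-digits : ∀ m c u v P t → (u * m + v) +[ c ] (P * m + t) ≡ (u +[ c ] P) * m + (v +[ c ] t)
carry-digits m false u v P t = refl
carry-digits m true  u v P t = add-digits m u v P t

half-below : ∀ m s t v → 2 * t ≤ m → v < m + s → t < m + s
half-below m s zero    v _     v<m+s = ≤-<-trans z≤n v<m+s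
half-below m s (suc t) v 2t≤m  _     =
  <-≤-trans (m<m+n (suc t) z<s) (≤-trans 2t≤m (m≤m+n m s))

module CirculantLayout (p s k : ℕ) (ps ss : Fin (suc k) → ℕ) (2≤p : 2 ≤ p)
                       (ps<p : ∀ i → ps i < p) (s≤ss : ∀ i → s ≤ ss i)
                       (ss≤sbar : ∀ i → ss i ≤ ss (fromℕ k)) where
  open Setup p s k ps ss

  rows-disjoint : ∀ {u} → u + 2 ≤ p → u + 1 ≡ p → ⊥
  rows-disjoint {u} u+2≤p u+1≡p = <-irrefl u+1≡p (≤-trans (≤-reflexive (sym (+-suc u 1))) u+2≤p)

  vertex-bounds : ∀ {m u v} → V m (u , v) → u < p × v < m + s
  vertex-bounds {m} {u} (inj₁ (u+2≤p , v<m)) =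
    ≤-trans (n≤1+n (suc u)) (subst (_≤ p) (+-comm u 2) u+2≤p) , ≤-trans v<m (m≤m+n m s)
  vertex-bounds {m} {u} (inj₂ (u+1≡p , v<m+s)) = ≤-reflexive (trans (+-comm 1 u) u+1≡p) , v<m+s

  vertex-top-row : ∀ {m u v} → V m (u , v) → m ≤ v → u + 1 ≡ p
  vertex-top-row (inj₁ (_ , v<m)) m≤v = ⊥-elim (<⇒≱ v<m m≤v)
  vertex-top-row (inj₂ (u+1≡p , _)) _ = u+1≡p

  lower-row-bound : ∀ {m u v} → u + 2 ≤ p → V m (u , v) → v < m
  lower-row-bound _     (inj₁ (_ , v<m))      = v<m
  lower-row-bound u+2≤p (inj₂ (u+1≡p , _)) = ⊥-elim (rows-disjoint u+2≤p u+1≡p)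

  Rset-intro : ∀ {m u v} → V m (u , v) →
    (u + 2 ≤ p → m ≤ v + sbar) → (u + 1 ≡ p → m + s ≤ v + sbar) → Rset m (u , v)
  Rset-intro {m} {v = v} (inj₁ (lower , v<m)) near-end _ =
    inj₁ (lower , m≤n+o⇒m∸n≤o m sbar (≤-trans (near-end lower) (≤-reflexive (+-comm v sbar))) , v<m)
  Rset-intro {m} {v = v} (inj₂ (top , v<m+s)) _ near-end =
    inj₂ (top , m≤n+o⇒m∸n≤o (m + s) sbar (≤-trans (near-end top) (≤-reflexive (+-comm v sbar))) , v<m+s)

  top-row-absorbs : ∀ i {u₁ u₂} → u₁ < p → u₂ + 1 ≡ p → u₁ + ps i < u₂ + p
  top-row-absorbs i {u₁} {u₂} u₁<p u₂+1≡p = s≤s⁻¹ (begin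
    suc (suc (u₁ + ps i))   ≡⟨ cong suc (sym (+-suc u₁ (ps i))) ⟩
    suc u₁ + suc (ps i)     ≤⟨ +-mono-≤ u₁<p (ps<p i) ⟩
    p + p                   ≡⟨ cong (_+ p) (sym u₂+1≡p) ⟩
    u₂ + 1 + p              ≡⟨ cong (_+ p) (+-comm u₂ 1) ⟩
    suc (u₂ + p)            ∎)
    where open ≤-Reasoning

  column-sum-bound : ∀ {m v} i → 2 * sbar ≤ m → v < m + s → v + ss i < m + m
  column-sum-bound {m} {v} i 2sbar≤m v<m+s = begin-strict
    v + ss i         <⟨ +-monoˡ-< (ss i) v<m+s ⟩
    m + s + ss i     ≡⟨ +-assoc m s (ss i) ⟩
    m + (s + ss i)   ≤⟨ +-monoʳ-≤ m (+-mono-≤ (s≤ss (fromℕ k)) (≤-trans (ss≤sbar i) (≤-reflexive (sym (+-identityʳ sbar))))) ⟩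
    m + 2 * sbar     ≤⟨ +-monoʳ-≤ m 2sbar≤m ⟩
    m + m            ∎
    where open ≤-Reasoning

  -- The two ways a jump of index i can move a vertex (u₁ , v₁) to (u₂ , v₂),
  -- where the carry bit c records a wrap-around by N = pm + s:
  -- a lattice step adds (p_i , s_i) to the coordinates,
  LatticeStep : Bool → Fin (suc k) → Edge → Set
  LatticeStep c i ((u₁ , v₁) , (u₂ , v₂)) =
    u₁ + ps i ≡ u₂ +[ c ] p × v₁ + ss i ≡ v₂ +[ c ] s

  -- and a hook step lets the column overflow by m into the next row.
  HookStep : ℕ → Bool → Fin (suc k) → Edge → Set
  HookStep m c i ((u₁ , v₁) , (u₂ , v₂)) =
    suc (u₁ + ps i) ≡ u₂ +[ c ] p × v₁ + ss i ≡ v₂ +[ c ] s + m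

  jump-as-digits : ∀ {m u₁ v₁ u₂ v₂} i → 2 * sbar ≤ m → V m (u₁ , v₁) → V m (u₂ , v₂) →
    Jump m i ((u₁ , v₁) , (u₂ , v₂)) →
    ∃ λ c → (u₁ + ps i) * m + (v₁ + ss i) ≡ (u₂ +[ c ] p) * m + (v₂ +[ c ] s)
  jump-as-digits {m} {u₁} {v₁} {u₂} {v₂} i 2sbar≤m Va Vb jump
    with carry-from-congruence (p * m + s) (u₂ * m + v₂) (u₁ * m + v₁) (ps i * m + ss i)
           (position-bound Vb) (+-mono-< (position-bound Va) offset-bound) jump
    where
    position-bound : ∀ {u v} → V m (u , v) → u * m + v < p * m + s
    position-bound {u} {v} Vx = digits-bound m s u v p (proj₁ (vertex-bounds Vx)) (proj₂ (vertex-bounds Vx))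
    offset-bound : ps i * m + ss i < p * m + s
    offset-bound = digits-bound m s (ps i) (ss i) p (ps<p i)
      (≤-<-trans (ss≤sbar i) (half-below m s sbar v₁ 2sbar≤m (proj₂ (vertex-bounds Va))))
  ... | c , wrapped = c , (begin
    (u₁ + ps i) * m + (v₁ + ss i)        ≡⟨ sym (add-digits m u₁ v₁ (ps i) (ss i)) ⟩
    (u₁ * m + v₁) + (ps i * m + ss i)    ≡⟨ sym wrapped ⟩
    (u₂ * m + v₂) +[ c ] (p * m + s)     ≡⟨ carry-digits m c u₂ v₂ p s ⟩
    (u₂ +[ c ] p) * m + (v₂ +[ c ] s)    ∎)
    where open ≡-Reasoning

  beyond-row : ∀ m v₁ i → m + s ≤ v₁ + ss i + m
  beyond-row m v₁ i =
    ≤-trans (≤-reflexive (+-comm m s)) (+-monoˡ-≤ m (≤-trans (s≤ss i) (m≤n+m (ss i) v₁)))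

  no-backward-step : ∀ {m u₁ v₁ u₂ v₂} c i → V m (u₁ , v₁) → V m (u₂ , v₂) →
    u₂ +[ c ] p < u₁ + ps i → v₁ + ss i + m ≤ v₂ +[ c ] s → ⊥
  no-backward-step {m} {v₁ = v₁} false i Va Vb backward far =
    <⇒≱ (proj₂ (vertex-bounds Vb)) (≤-trans (beyond-row m v₁ i) far)
  no-backward-step {m} {v₁ = v₁} {v₂ = v₂} true i Va Vb backward far =
    <-asym backward (top-row-absorbs i (proj₁ (vertex-bounds Va)) (vertex-top-row Vb m≤v₂))
    where
    m≤v₂ : m ≤ v₂
    m≤v₂ = +-cancelʳ-≤ s m v₂ (≤-trans (beyond-row m v₁ i) far)

  jump-classification : ∀ {m u₁ v₁ u₂ v₂} i → 2 * sbar ≤ m → V m (u₁ , v₁) → V m (u₂ , v₂) →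
    Jump m i ((u₁ , v₁) , (u₂ , v₂)) →
    ∃ λ c → LatticeStep c i ((u₁ , v₁) , (u₂ , v₂)) ⊎ HookStep m c i ((u₁ , v₁) , (u₂ , v₂))
  jump-classification {m} {u₁} {v₁} {u₂} {v₂} i 2sbar≤m Va Vb jump
    with jump-as-digits i 2sbar≤m Va Vb jump
  ... | c , digits
    with digits-compare m (u₁ + ps i) (v₁ + ss i) (u₂ +[ c ] p) (v₂ +[ c ] s) digits
           (column-sum-bound i 2sbar≤m (proj₂ (vertex-bounds Va)))
  ...   | inj₁ lattice                  = c , inj₁ lattice
  ...   | inj₂ (inj₁ hook)              = c , inj₂ hook
  ...   | inj₂ (inj₂ (backward , far)) = ⊥-elim (no-backward-step c i Va Vb backward far)

  lattice-edge : ∀ {m u₁ v₁ u₂ v₂} c i → V m (u₁ , v₁) → V m (u₂ , v₂) →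
    LatticeStep c i ((u₁ , v₁) , (u₂ , v₂)) → EL m ((u₁ , v₁) , (u₂ , v₂))
  lattice-edge {m} {u₁} {v₁} {u₂} {v₂} c i Va Vb (rows , columns) =
    Va , Vb , i ,
    congruence-from-carry (p * m + s) c (u₂ * m + v₂) (u₁ * m + v₁) (ps i * m + ss i) positions ,
    congruence-from-carry p c u₂ u₁ (ps i) (sym rows)
    where
    open ≡-Reasoning
    positions : (u₂ * m + v₂) +[ c ] (p * m + s) ≡ (u₁ * m + v₁) + (ps i * m + ss i)
    positions = begin
      (u₂ * m + v₂) +[ c ] (p * m + s)    ≡⟨ carry-digits m c u₂ v₂ p s ⟩
      (u₂ +[ c ] p) * m + (v₂ +[ c ] s)   ≡⟨ cong₂ (λ x y → x * m + y) (sym rows) (sym columns) ⟩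
      (u₁ + ps i) * m + (v₁ + ss i)       ≡⟨ sym (add-digits m u₁ v₁ (ps i) (ss i)) ⟩
      (u₁ * m + v₁) + (ps i * m + ss i)   ∎

  hook-breaks-row-congruence : ∀ {m u₁ v₁ u₂ v₂} c i → u₁ < p → u₂ < p →
    HookStep m c i ((u₁ , v₁) , (u₂ , v₂)) → ¬ ((+ u₂ -ℤ + u₁) ≡ + ps i [mod p ])
  hook-breaks-row-congruence {u₁ = u₁} {u₂ = u₂} c i u₁<p u₂<p (rows , _) congruent
    with carry-from-congruence p u₂ u₁ (ps i) u₂<p (+-mono-< u₁<p (ps<p i)) congruent
  ... | c′ , rows′ = <⇒≢ 2≤p (sym (carry-step c c′ u₂ p (trans (sym rows) (cong suc (sym rows′)))))

  -- Hence every edge of L_m is a lattice step.  (Here and below the vertex coordinates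
  -- are passed explicitly: inferring them from the unfolded congruences is very costly.)
  lattice-step-of-edge : ∀ {m u₁ v₁ u₂ v₂} → 2 * sbar ≤ m → EL m ((u₁ , v₁) , (u₂ , v₂)) →
    Σ (Fin (suc k)) λ i → ∃ λ c → LatticeStep c i ((u₁ , v₁) , (u₂ , v₂))
  lattice-step-of-edge {m} {u₁} {v₁} {u₂} {v₂} 2sbar≤m (Va , Vb , i , jump , congruent) =
    i , proj₁ classified , [ (λ step → step) , (λ hook → ⊥-elim (not-hook hook)) ]′ (proj₂ classified)
    where
    classified : ∃ λ c → LatticeStep c i ((u₁ , v₁) , (u₂ , v₂)) ⊎ HookStep m c i ((u₁ , v₁) , (u₂ , v₂))
    classified = jump-classification {m} {u₁} {v₁} {u₂} {v₂} i 2sbar≤m Va Vb jump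
    not-hook : ¬ HookStep m (proj₁ classified) i ((u₁ , v₁) , (u₂ , v₂))
    not-hook hook = hook-breaks-row-congruence {m} {u₁} {v₁} {u₂} {v₂} (proj₁ classified) i
      (proj₁ (vertex-bounds Va)) (proj₁ (vertex-bounds Vb)) hook congruent

  overflow-source-lower-row : ∀ {u₁ u₂} i → u₂ < p → suc (u₁ + ps i) ≡ u₂ → u₁ + 2 ≤ p
  overflow-source-lower-row {u₁} i u₂<p overflow = subst (_≤ p) (+-comm 2 u₁)
    (≤-trans (s≤s (s≤s (m≤m+n u₁ (ps i)))) (≤-trans (≤-reflexive (cong suc overflow)) u₂<p))

  hook-source-column : ∀ {m u₁ v₁ u₂ v₂} c i → V m (u₁ , v₁) → u₂ < p →
    HookStep m c i ((u₁ , v₁) , (u₂ , v₂)) → v₁ < m +[ c ] s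
  hook-source-column false i Va u₂<p hook = lower-row-bound (overflow-source-lower-row i u₂<p (proj₁ hook)) Va
  hook-source-column true  i Va u₂<p hook = proj₂ (vertex-bounds Va)

  hook-source-depth : ∀ {m u₁ v₁ u₂ v₂} c i →
    HookStep m c i ((u₁ , v₁) , (u₂ , v₂)) → m +[ c ] s ≤ v₁ + sbar
  hook-source-depth {m} {v₁ = v₁} {v₂ = v₂} c i (_ , columns) = begin
    m +[ c ] s          ≤⟨ m≤n+m _ v₂ ⟩
    v₂ + (m +[ c ] s)   ≡⟨ sym (+[]-swap v₂ c s m) ⟩
    v₂ +[ c ] s + m     ≡⟨ sym columns ⟩
    v₁ + ss i           ≤⟨ +-monoʳ-≤ v₁ (ss≤sbar i) ⟩
    v₁ + sbar           ∎
    where open ≤-Reasoning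

  hook-target-column : ∀ {m u₁ v₁ u₂ v₂} c i → v₁ < m +[ c ] s →
    HookStep m c i ((u₁ , v₁) , (u₂ , v₂)) → v₂ < sbar
  hook-target-column {m} {v₁ = v₁} {v₂ = v₂} c i v₁<M (_ , columns) =
    +-cancelʳ-< (m +[ c ] s) v₂ sbar (begin-strict
      v₂ + (m +[ c ] s)       ≡⟨ sym (+[]-swap v₂ c s m) ⟩
      v₂ +[ c ] s + m         ≡⟨ sym columns ⟩
      v₁ + ss i               <⟨ +-monoˡ-< (ss i) v₁<M ⟩
      m +[ c ] s + ss i       ≤⟨ +-monoʳ-≤ (m +[ c ] s) (ss≤sbar i) ⟩
      m +[ c ] s + sbar       ≡⟨ +-comm (m +[ c ] s) sbar ⟩
      sbar + (m +[ c ] s)     ∎)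
    where open ≤-Reasoning

  hook-source-in-R : ∀ {m u₁ v₁ u₂ v₂} c i → V m (u₁ , v₁) → u₂ < p →
    HookStep m c i ((u₁ , v₁) , (u₂ , v₂)) → Rset m (u₁ , v₁)
  hook-source-in-R false i Va u₂<p hook = Rset-intro Va
    (λ _ → hook-source-depth false i hook)
    (λ top → ⊥-elim (rows-disjoint (overflow-source-lower-row i u₂<p (proj₁ hook)) top))
  hook-source-in-R {m} true i Va u₂<p hook = Rset-intro Va
    (λ _ → ≤-trans (m≤m+n m s) (hook-source-depth true i hook))
    (λ _ → hook-source-depth true i hook)

  hook-endpoints : ∀ {m} a b → 2 * sbar ≤ m → Hook m (a , b) → Rset m a × Lset m b
  hook-endpoints {m} (u₁ , v₁) (u₂ , v₂) 2sbar≤m ((Va , Vb , i , jump) , not-lattice) =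
    endpoints (jump-classification {m} {u₁} {v₁} {u₂} {v₂} i 2sbar≤m Va Vb jump)
    where
    u₂<p : u₂ < p
    u₂<p = proj₁ (vertex-bounds Vb)
    endpoints : (∃ λ c → LatticeStep c i ((u₁ , v₁) , (u₂ , v₂)) ⊎ HookStep m c i ((u₁ , v₁) , (u₂ , v₂))) →
      Rset m (u₁ , v₁) × Lset m (u₂ , v₂)
    endpoints (c , inj₁ step) = ⊥-elim (not-lattice (lattice-edge c i Va Vb step))
    endpoints (c , inj₂ hook) = hook-source-in-R c i Va u₂<p hook , u₂<p ,
      hook-target-column {m} {u₁} {v₁} {u₂} {v₂} c i (hook-source-column c i Va u₂<p hook) hook

  V? : ∀ m x → Dec (V m x)
  V? m (u , v) = ((u + 2 ≤? p) ×-dec (v <? m)) ⊎-dec ((u + 1 ≟ p) ×-dec (v <? m + s))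

  new-vertex-position : ∀ {m u v} → V (suc m) (u , v) → ¬ V m (u , v) →
    (u + 2 ≤ p × v ≡ m) ⊎ (u + 1 ≡ p × v ≡ m + s)
  new-vertex-position {m} {v = v} (inj₁ (lower , v<1+m)) old with v <? m
  ... | yes v<m = ⊥-elim (old (inj₁ (lower , v<m)))
  ... | no  v≮m = inj₁ (lower , ≤-antisym (s≤s⁻¹ v<1+m) (≮⇒≥ v≮m))
  new-vertex-position {m} {v = v} (inj₂ (top , v<1+m+s)) old with v <? m + s
  ... | yes v<m+s = ⊥-elim (old (inj₂ (top , v<m+s)))
  ... | no  v≮m+s = inj₂ (top , ≤-antisym (s≤s⁻¹ v<1+m+s) (≮⇒≥ v≮m+s))

  new-vertex-column : ∀ {m u v} → (u + 2 ≤ p × v ≡ m) ⊎ (u + 1 ≡ p × v ≡ m + s) → m ≤ v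
  new-vertex-column {m} (inj₁ (_ , v≡m))   = ≤-reflexive (sym v≡m)
  new-vertex-column {m} (inj₂ (_ , v≡m+s)) = ≤-trans (m≤m+n m s) (≤-reflexive (sym v≡m+s))

  step-reach : ∀ {m v₁ w} i → m ≤ v₁ → v₁ + ss i ≡ w → m + s ≤ w
  step-reach i m≤v₁ columns = ≤-trans (+-mono-≤ m≤v₁ (s≤ss i)) (≤-reflexive columns)

  no-step-from-new-vertex : ∀ {m u₁ v₁ u₂ v₂} c i → m ≤ v₁ → u₁ < p → V m (u₂ , v₂) →
    ¬ LatticeStep c i ((u₁ , v₁) , (u₂ , v₂))
  no-step-from-new-vertex false i m≤v₁ u₁<p Vb (_ , columns) =
    <⇒≱ (proj₂ (vertex-bounds Vb)) (step-reach i m≤v₁ columns)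
  no-step-from-new-vertex {m} {v₂ = v₂} true i m≤v₁ u₁<p Vb (rows , columns) =
    <-irrefl rows (top-row-absorbs i u₁<p (vertex-top-row Vb (+-cancelʳ-≤ s m v₂ (step-reach i m≤v₁ columns))))

  step-from-top-into-new-vertex : ∀ {m u₁ u₂ v₂} c i → (u₂ + 2 ≤ p × v₂ ≡ m) ⊎ (u₂ + 1 ≡ p × v₂ ≡ m + s) →
    u₁ + ps i ≡ u₂ +[ c ] p → u₁ + 1 ≡ p → m + s ≤ v₂ +[ c ] s
  step-from-top-into-new-vertex {u₁ = u₁} false i (inj₁ (lower , _)) rows top =
    ⊥-elim (rows-disjoint (≤-trans (+-monoˡ-≤ 2 (≤-trans (m≤m+n u₁ (ps i)) (≤-reflexive rows))) lower) top)
  step-from-top-into-new-vertex false i (inj₂ (_ , v₂≡m+s)) _ _ = ≤-reflexive (sym v₂≡m+s)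
  step-from-top-into-new-vertex true  i new _ _ = +-monoˡ-≤ s (new-vertex-column new)

  step-into-new-vertex : ∀ {m u₁ v₁ u₂ v₂} c i → V m (u₁ , v₁) →
    (u₂ + 2 ≤ p × v₂ ≡ m) ⊎ (u₂ + 1 ≡ p × v₂ ≡ m + s) →
    LatticeStep c i ((u₁ , v₁) , (u₂ , v₂)) → Rset m (u₁ , v₁)
  step-into-new-vertex {v₁ = v₁} {v₂ = v₂} c i Va new (rows , columns) = Rset-intro Va
    (λ _ → reach (≤-trans (new-vertex-column new) (≤-+[] v₂ c s)))
    (λ top → reach (step-from-top-into-new-vertex c i new rows top))
    where
    reach : ∀ {x} → x ≤ v₂ +[ c ] s → x ≤ v₁ + sbar
    reach x≤ = ≤-trans x≤ (≤-trans (≤-reflexive (sym columns)) (+-monoʳ-≤ v₁ (ss≤sbar i)))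

  new-endpoints : ∀ {m} a b → 2 * sbar ≤ m → New m (a , b) → (Rset m a × NV m b) ⊎ (NV m a × NV m b)
  new-endpoints {m} (u₁ , v₁) (u₂ , v₂) 2sbar≤m (edge@(Va′ , Vb′ , _) , not-old) =
    endpoints (lattice-step-of-edge {suc m} {u₁} {v₁} {u₂} {v₂} (≤-trans 2sbar≤m (n≤1+n m)) edge)
      (V? m (u₁ , v₁)) (V? m (u₂ , v₂))
    where
    endpoints : (Σ (Fin (suc k)) λ i → ∃ λ c → LatticeStep c i ((u₁ , v₁) , (u₂ , v₂))) →
      Dec (V m (u₁ , v₁)) → Dec (V m (u₂ , v₂)) →
      (Rset m (u₁ , v₁) × NV m (u₂ , v₂)) ⊎ (NV m (u₁ , v₁) × NV m (u₂ , v₂))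
    endpoints (i , c , step) (yes Va)  (yes Vb)  = ⊥-elim (not-old (lattice-edge c i Va Vb step))
    endpoints (i , c , step) (no  ¬Va) (yes Vb)  = ⊥-elim (no-step-from-new-vertex c i
      (new-vertex-column (new-vertex-position Va′ ¬Va)) (proj₁ (vertex-bounds Va′)) Vb step)
    endpoints (i , c , step) (yes Va)  (no  ¬Vb) =
      inj₁ (step-into-new-vertex c i Va (new-vertex-position Vb′ ¬Vb) step , Vb′ , ¬Vb)
    endpoints _              (no  ¬Va) (no  ¬Vb) = inj₂ ((Va′ , ¬Va) , (Vb′ , ¬Vb))

lemma9 : (p s k : ℕ) (ps ss : Fin (suc k) → ℕ) →
    2 ≤ p →
    (∀ i → ps i < p) →
    (∀ i → s ≤ ss i) →
    (∀ i → ss i ≤ ss (fromℕ k)) →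
    (n : ℕ) → 2 * ss (fromℕ k) ≤ n →
    let open Setup p s k ps ss in
    (∀ a b → Hook n (a , b) → Rset n a × Lset n b) ×
    (∀ a b → New n (a , b) → (Rset n a × NV n b) ⊎ (NV n a × NV n b))
lemma9 p s k ps ss 2≤p ps<p s≤ss ss≤sbar n 2sbar≤n =
  (λ a b → hook-endpoints a b 2sbar≤n) , (λ a b → new-endpoints a b 2sbar≤n)
  where open CirculantLayout p s k ps ss 2≤p ps<p s≤ss ss≤sbar
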